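{- For all integers $n\ge0$ and $m\ge1$, $$\delta_n(2m)=\delta_n^1(2m)=\delta_n^2(2m)=\delta_n^3(2m)=0;$$ that is, every term of Stern's triatomic sequence is odd.
   Context: Let $A_0=\begin{pmatrix}1&0&1\\0&1&1\\0&0&1\end{pmatrix}$, $A_1=\begin{pmatrix}0&0&1\\1&0&1\\0&1&1\end{pmatrix}$, $A_2=\begin{pmatrix}0&1&1\\0&0&1\\1&0&1\end{pmatrix}$. For a tuple $J=(j_1,\dots,j_n)$ with $j_i\in\{0,1,2\}$ ($n\ge0$) set $(v_1(J),v_2(J),v_3(J))=(1,1,1)A_{j_1}\cdots A_{j_n}$; these numbers, over all $J$ of length $n$, are the level-$n$ terms of Stern's triatomic sequence. For an integer $m$, $\delta_n(m)$ is the number of pairs $(J,k)$ with $J$ of length $n$, $k\in\{1,2,3\}$ and $v_k(J)=m$; for fixed $k\in\{1,2,3\}$, $\delta_n^k(m)$ is the number of tuples $J$ of length $n$ with $v_k(J)=m$. -}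

module Defs where

open import Data.Nat using (ℕ; zero; suc; _+_; _*_)
open import Data.Nat.Properties using (_≟_)
open import Data.Fin using (Fin; zero; suc)
open import Data.Vec using (Vec; []; _∷_)
open import Data.List using (List; []; _∷_; map; concatMap; length; filter)
open import Data.Product using (_×_; _,_)
open import Relation.Nullary.Decidable using (Dec)
open import Relation.Binary.PropositionalEquality using (_≡_)

-- 3x3 matrices over ℕ as functions; entry (i , j) is row i, column j.
Mat3 : Set
Mat3 = Fin 3 → Fin 3 → ℕ

Row3 : Set
Row3 = Fin 3 → ℕ

mat : ℕ → ℕ → ℕ → ℕ → ℕ → ℕ → ℕ → ℕ → ℕ → Mat3
mat a b c d e f g h i zero zero = a
mat a b c d e f g h i zero (suc zero) = b
mat a b c d e f g h i zero (suc (suc zero)) = c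
mat a b c d e f g h i (suc zero) zero = d
mat a b c d e f g h i (suc zero) (suc zero) = e
mat a b c d e f g h i (suc zero) (suc (suc zero)) = f
mat a b c d e f g h i (suc (suc zero)) zero = g
mat a b c d e f g h i (suc (suc zero)) (suc zero) = h
mat a b c d e f g h i (suc (suc zero)) (suc (suc zero)) = i

A : Fin 3 → Mat3
A zero             = mat 1 0 1  0 1 1  0 0 1
A (suc zero)       = mat 0 0 1  1 0 1  0 1 1
A (suc (suc zero)) = mat 0 1 1  0 0 1  1 0 1

_·_ : Row3 → Mat3 → Row3
(v · M) j = v zero * M zero j + v (suc zero) * M (suc zero) j + v (suc (suc zero)) * M (suc (suc zero)) j

actOn : ∀ {n} → Row3 → Vec (Fin 3) n → Row3
actOn v []       = v
actOn v (j ∷ js) = actOn (v · A j) js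

-- (v₁(J), v₂(J), v₃(J)) = (1,1,1) A_{j₁} ⋯ A_{jₙ}; coordinate k ∈ Fin 3
-- (zero ↦ v₁, suc zero ↦ v₂, suc (suc zero) ↦ v₃).
v : ∀ {n} → Vec (Fin 3) n → Fin 3 → ℕ
v J = actOn (λ _ → 1) J

allFin3 : List (Fin 3)
allFin3 = zero ∷ suc zero ∷ suc (suc zero) ∷ []

tuples : (n : ℕ) → List (Vec (Fin 3) n)
tuples zero    = [] ∷ []
tuples (suc n) = concatMap (λ j → map (j ∷_) (tuples n)) allFin3

δᵏ : (n : ℕ) → Fin 3 → ℕ → ℕ
δᵏ n k m = length (filter (λ J → v J k ≟ m) (tuples n))

δ : (n : ℕ) → ℕ → ℕ
δ n m = length (filter (λ Jk → v (Data.Product.proj₁ Jk) (Data.Product.proj₂ Jk) ≟ m)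
                 (concatMap (λ J → map (λ k → J , k) allFin3) (tuples n)))

-- Reduce modulo 2. Parity is a semiring homomorphism ℕ → ℤ/2, so the parities
-- of w · M depend only on the parities of w. When w is all odd they are those
-- of (1,1,1) A_j, i.e. the column weights of A_j, which are 1, 1 and 3.
-- Hence right multiplication by any A_j preserves "all entries odd", and by
-- induction on J every v_k(J) is odd, so no term equals an even number 2m.
module Submission where

open import Defs
open import Data.Nat using (ℕ; _≤_; _+_; _*_; parity)
open import Data.Nat.Properties using (_≟_)
open import Data.Parity.Base as ℙ using (1ℙ)
open import Data.Parity.Properties using (+-homo-+; *-homo-*)
open import Data.Fin using (Fin; zero; suc)
open import Data.Vec using (Vec; []; _∷_)
open import Data.List using (List; filter; length; map; concatMap)
open import Data.List.Properties using (filter-none)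
open import Data.List.Relation.Unary.All using (tabulate)
open import Data.Product using (_×_; _,_)
open import Relation.Nullary using (¬_)
open import Relation.Unary using (Pred; Decidable)
open import Relation.Binary.PropositionalEquality
  using (_≡_; refl; sym; trans; cong; cong₂; subst; module ≡-Reasoning)

Odd : ℕ → Set
Odd n = parity n ≡ 1ℙ

AllOdd : Row3 → Set
AllOdd w = ∀ k → Odd (w k)

even-not-odd : ∀ m → ¬ Odd (2 * m)
even-not-odd m odd with () ← trans (sym (*-homo-* 2 m)) odd

parity-dot₃ : ∀ a b c x y z → parity (a * x + b * y + c * z) ≡
  (parity a ℙ.* parity x) ℙ.+ (parity b ℙ.* parity y) ℙ.+ (parity c ℙ.* parity z)
parity-dot₃ a b c x y z = begin
  parity (a * x + b * y + c * z)
    ≡⟨ +-homo-+ (a * x + b * y) (c * z) ⟩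
  parity (a * x + b * y) ℙ.+ parity (c * z)
    ≡⟨ cong₂ ℙ._+_ (+-homo-+ (a * x) (b * y)) (*-homo-* c z) ⟩
  parity (a * x) ℙ.+ parity (b * y) ℙ.+ (parity c ℙ.* parity z)
    ≡⟨ cong₂ (λ p q → p ℙ.+ q ℙ.+ (parity c ℙ.* parity z)) (*-homo-* a x) (*-homo-* b y) ⟩
  (parity a ℙ.* parity x) ℙ.+ (parity b ℙ.* parity y) ℙ.+ (parity c ℙ.* parity z)
    ∎
  where open ≡-Reasoning

·-cong-parity : ∀ {w w′ : Row3} → (∀ i → parity (w i) ≡ parity (w′ i)) →
                ∀ M k → parity ((w · M) k) ≡ parity ((w′ · M) k)
·-cong-parity {w} {w′} w∼w′ M k
  rewrite parity-dot₃ (w zero) (w (suc zero)) (w (suc (suc zero)))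
                      (M zero k) (M (suc zero) k) (M (suc (suc zero)) k)
        | parity-dot₃ (w′ zero) (w′ (suc zero)) (w′ (suc (suc zero)))
                      (M zero k) (M (suc zero) k) (M (suc (suc zero)) k)
        | w∼w′ zero | w∼w′ (suc zero) | w∼w′ (suc (suc zero)) = refl

ones·A-odd : ∀ j k → Odd (((λ _ → 1) · A j) k)
ones·A-odd zero             zero             = refl
ones·A-odd zero             (suc zero)       = refl
ones·A-odd zero             (suc (suc zero)) = refl
ones·A-odd (suc zero)       zero             = refl
ones·A-odd (suc zero)       (suc zero)       = refl
ones·A-odd (suc zero)       (suc (suc zero)) = refl
ones·A-odd (suc (suc zero)) zero             = refl
ones·A-odd (suc (suc zero)) (suc zero)       = refl
ones·A-odd (suc (suc zero)) (suc (suc zero)) = refl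

·A-preserves-AllOdd : ∀ {w} j → AllOdd w → AllOdd (w · A j)
·A-preserves-AllOdd {w} j odd k =
  trans (·-cong-parity {w} {λ _ → 1} odd (A j) k) (ones·A-odd j k)

actOn-preserves-AllOdd : ∀ {n w} (J : Vec (Fin 3) n) → AllOdd w → AllOdd (actOn w J)
actOn-preserves-AllOdd []      odd = odd
actOn-preserves-AllOdd {w = w} (j ∷ J) odd =
  actOn-preserves-AllOdd J (·A-preserves-AllOdd {w} j odd)

v-odd : ∀ {n} (J : Vec (Fin 3) n) → AllOdd (v J)
v-odd J = actOn-preserves-AllOdd J (λ _ → refl)

v≢even : ∀ {n} (J : Vec (Fin 3) n) k m → ¬ v J k ≡ 2 * m
v≢even J k m v≡2m = even-not-odd m (subst Odd v≡2m (v-odd J k))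

length-filter-none : ∀ {a p} {X : Set a} {P : Pred X p} (P? : Decidable P) →
                     (∀ x → ¬ P x) → (xs : List X) → length (filter P? xs) ≡ 0
length-filter-none P? ¬P xs =
  cong length (filter-none P? {xs = xs} (tabulate (λ {x} _ → ¬P x)))

mainTheorem7 : (n m : ℕ) → 1 ≤ m →
    (δ n (2 * m) ≡ 0) × ((k : Fin 3) → δᵏ n k (2 * m) ≡ 0)
mainTheorem7 n m _ =
    length-filter-none (λ (J , k) → v J k ≟ 2 * m) (λ (J , k) → v≢even J k m)
      (concatMap (λ J → map (λ k → J , k) allFin3) (tuples n))
  , λ k → length-filter-none (λ J → v J k ≟ 2 * m) (λ J → v≢even J k m) (tuples n)
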